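{- Let $\mathbb{C}$ be a small category equipped with an independent-pullback structure. Then the composite functor $\mathbf{a}\mathbf{y}\colon\mathbb{C}\to\mathrm{Sh}_{\mathrm{at}}(\mathbb{C})$ (Yoneda embedding followed by the associated-sheaf functor) maps every independent square in $\mathbb{C}$ to a pushout square in $\mathrm{Sh}_{\mathrm{at}}(\mathbb{C})$.
   Context: Such a $\mathbb{C}$ is coconfluent, so the atomic Grothendieck topology exists; $\mathrm{Sh}_{\mathrm{at}}(\mathbb{C})$ is the full subcategory of presheaves $P\colon\mathbb{C}^{op}\to\mathbf{Set}$ that are atomic sheaves (for every $c\colon Y\to X$, every $y\in P(Y)$ with $y\cdot d=y\cdot e$ whenever $c\circ d=c\circ e$ is of the form $x\cdot c$ for a unique $x\in P(X)$, where $x\cdot c:=P(c)(x)$), and $\mathbf{a}$ is the left adjoint to the inclusion of sheaves into presheaves. A square is a commuting diagram with apex $X$, legs $f\colon X\to Y$, $g\colon X\to Z$ and cospan $u\colon Y\to W$, $v\colon Z\to W$. An independent-pullback structure is a class of commuting squares (independent squares) such that, calling an independent square an independent pullback if every independent square over the same cospan factors through it by a unique map compatible with the legs: (IP1) for every $f\colon X\to Y$ the square with legs $\mathrm{id}_X, f$ and cospan $f,\mathrm{id}_Y$ is independent; (IP2) independence is invariant under swapping the two legs/cospan maps; (IP3) pasting two independent squares side by side gives an independent rectangle; (IP4) if the pasted rectangle is independent and the right square is an independent pullback then the left square is independent; (IP5) every cospan completes to an independent pullback. -}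

module Defs where

open import Level using (Level; 0ℓ) renaming (suc to lsuc)
open import Data.Product using (Σ; Σ-syntax; _×_; _,_)
open import Relation.Binary.PropositionalEquality using (_≡_; refl; sym; trans; cong)

record Category : Set₁ where
  infixr 9 _∘_
  field
    Obj   : Set
    Hom   : Obj → Obj → Set
    id    : ∀ {A} → Hom A A
    _∘_   : ∀ {A B C} → Hom B C → Hom A B → Hom A C
    idˡ   : ∀ {A B} (f : Hom A B) → id ∘ f ≡ f
    idʳ   : ∀ {A B} (f : Hom A B) → f ∘ id ≡ f
    assoc : ∀ {A B C D} (h : Hom C D) (g : Hom B C) (f : Hom A B) →
            (h ∘ g) ∘ f ≡ h ∘ (g ∘ f)

module _ (𝒞 : Category) where
  open Category 𝒞

  -- Independent-pullback structures.
  -- A square is given by apex X, legs f : X → Y, g : X → Z and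
  -- cospan u : Y → W, v : Z → W (commuting: u ∘ f ≡ v ∘ g).

  IsIndepPullback : (Indep : ∀ {X Y Z W} → Hom X Y → Hom X Z → Hom Y W → Hom Z W → Set) →
                    ∀ {X Y Z W} → Hom X Y → Hom X Z → Hom Y W → Hom Z W → Set
  IsIndepPullback Indep {X} {Y} {Z} {W} f g u v =
    Indep f g u v ×
    (∀ {X'} (f' : Hom X' Y) (g' : Hom X' Z) → Indep f' g' u v →
       Σ[ h ∈ Hom X' X ] ((f ∘ h ≡ f') × (g ∘ h ≡ g') ×
         (∀ (h' : Hom X' X) → f ∘ h' ≡ f' → g ∘ h' ≡ g' → h' ≡ h)))

  record IndepPullbackStructure : Set₁ where
    field
      Indep : ∀ {X Y Z W} → Hom X Y → Hom X Z → Hom Y W → Hom Z W → Set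
      indep-comm : ∀ {X Y Z W} {f : Hom X Y} {g : Hom X Z} {u : Hom Y W} {v : Hom Z W} →
                   Indep f g u v → u ∘ f ≡ v ∘ g
      IP1 : ∀ {X Y} (f : Hom X Y) → Indep id f f id
      IP2 : ∀ {X Y Z W} {f : Hom X Y} {g : Hom X Z} {u : Hom Y W} {v : Hom Z W} →
            Indep f g u v → Indep g f v u
      IP3 : ∀ {X Y Z W Y' W'} {f : Hom X Y} {g : Hom X Z} {u : Hom Y W} {v : Hom Z W}
              {f' : Hom Y Y'} {u' : Hom Y' W'} {v' : Hom W W'} →
            Indep f g u v → Indep f' u u' v' → Indep (f' ∘ f) g u' (v' ∘ v)
      IP4 : ∀ {X Y Z W Y' W'} {f : Hom X Y} {g : Hom X Z} {u : Hom Y W} {v : Hom Z W}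
              {f' : Hom Y Y'} {u' : Hom Y' W'} {v' : Hom W W'} →
            u ∘ f ≡ v ∘ g →
            Indep (f' ∘ f) g u' (v' ∘ v) → IsIndepPullback Indep f' u u' v' →
            Indep f g u v
      IP5 : ∀ {Y Z W} (u : Hom Y W) (v : Hom Z W) →
            Σ[ X ∈ Obj ] Σ[ f ∈ Hom X Y ] Σ[ g ∈ Hom X Z ] IsIndepPullback Indep f g u v

  -- Presheaves  𝒞^op → Set  (right action notation x · c = P(c)(x)).

  record Presheaf : Set₁ where
    infixl 8 _·_
    field
      F₀     : Obj → Set
      _·_    : ∀ {A B} → F₀ B → Hom A B → F₀ A
      act-id : ∀ {A} (x : F₀ A) → x · id ≡ x
      act-∘  : ∀ {A B C} (x : F₀ C) (f : Hom B C) (g : Hom A B) →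
               x · (f ∘ g) ≡ (x · f) · g

  open Presheaf

  record _⇒_ (P Q : Presheaf) : Set where
    field
      η       : ∀ A → F₀ P A → F₀ Q A
      natural : ∀ {A B} (x : F₀ P B) (f : Hom A B) →
                η A (_·_ P x f) ≡ _·_ Q (η B x) f
  open _⇒_

  _≈_ : ∀ {P Q} → P ⇒ Q → P ⇒ Q → Set
  α ≈ β = ∀ A x → η α A x ≡ η β A x

  idN : ∀ {P} → P ⇒ P
  idN = record { η = λ A x → x ; natural = λ x f → refl }

  _∘N_ : ∀ {P Q R} → Q ⇒ R → P ⇒ Q → P ⇒ R
  β ∘N α = record
    { η = λ A x → η β A (η α A x)
    ; natural = λ x f → trans (cong (η β _) (natural α x f)) (natural β (η α _ x) f) }

  y₀ : Obj → Presheaf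
  y₀ X = record
    { F₀ = λ A → Hom A X
    ; _·_ = λ f g → f ∘ g
    ; act-id = idʳ
    ; act-∘ = λ x f g → sym (assoc x f g) }

  y₁ : ∀ {X X'} → Hom X X' → y₀ X ⇒ y₀ X'
  y₁ h = record { η = λ A f → h ∘ f ; natural = λ x f → sym (assoc h x f) }

  IsAtomicSheaf : Presheaf → Set
  IsAtomicSheaf P =
    ∀ {A B} (c : Hom B A) (y : F₀ P B) →
      (∀ {D} (d e : Hom D B) → c ∘ d ≡ c ∘ e → _·_ P y d ≡ _·_ P y e) →
      Σ[ x ∈ F₀ P A ] ((_·_ P x c ≡ y) × (∀ (x' : F₀ P A) → _·_ P x' c ≡ y → x' ≡ x))

  -- Sh_at(𝒞) is the full subcategory of presheaves on the atomic sheaves.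

  -- A left adjoint  a  to the inclusion Sh_at(𝒞) ↪ PSh(𝒞), presented by
  -- its object part, action on morphisms and a universal unit.

  record AssociatedSheaf : Set₂ where
    field
      a₀        : Presheaf → Presheaf
      a₀-sheaf  : ∀ P → IsAtomicSheaf (a₀ P)
      a₁        : ∀ {P Q} → P ⇒ Q → a₀ P ⇒ a₀ Q
      unit      : ∀ P → P ⇒ a₀ P
      unit-natural : ∀ {P Q} (α : P ⇒ Q) → (a₁ α ∘N unit P) ≈ (unit Q ∘N α)
      universal : ∀ P (F : Presheaf) → IsAtomicSheaf F → (α : P ⇒ F) →
                  Σ[ β ∈ a₀ P ⇒ F ] ((β ∘N unit P) ≈ α ×
                    (∀ (β' : a₀ P ⇒ F) → (β' ∘N unit P) ≈ α → β' ≈ β))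

  IsPushoutSh : ∀ {PX PY PZ PW} → PX ⇒ PY → PX ⇒ PZ → PY ⇒ PW → PZ ⇒ PW → Set₁
  IsPushoutSh {PX} {PY} {PZ} {PW} f g u v =
    ((u ∘N f) ≈ (v ∘N g)) ×
    (∀ (F : Presheaf) → IsAtomicSheaf F → (p : PY ⇒ F) (q : PZ ⇒ F) →
       (p ∘N f) ≈ (q ∘N g) →
       Σ[ k ∈ PW ⇒ F ] (((k ∘N u) ≈ p) × ((k ∘N v) ≈ q) ×
         (∀ (k' : PW ⇒ F) → (k' ∘N u) ≈ p → (k' ∘N v) ≈ q → k' ≈ k)))

-- An atomic sheaf F sends every independent square to a pullback of sets: given p ∈ F Y and
-- q ∈ F Z with p · f ≡ q · g, the element p is a matching family for u (two maps equalised
-- by u are compared through an independent pullback over v, which every independent square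
-- pasted onto the given one factors through), so it glues uniquely to some w ∈ F W, and the
-- same comparison shows w · v ≡ q.  Since maps a (y V) ⇒ F into a sheaf are the elements of
-- F V, with precomposition by a (y c) acting as · c, this says that a ∘ y sends the square
-- to a pushout.
module Submission where

open import Defs
open import Data.Product using (Σ; Σ-syntax; _×_; _,_; proj₁; proj₂)
open import Relation.Binary.PropositionalEquality

module _ {𝒞 : Category} where
  open Category 𝒞
  open _⇒_

  private variable
    A B D V X Y Z W : Obj

  MapsToPullback : Presheaf 𝒞 → Hom X Y → Hom X Z → Hom Y W → Hom Z W → Set
  MapsToPullback {Y = Y} {Z = Z} {W = W} F f g u v =
    let open Presheaf F in
    ∀ (p : F₀ Y) (q : F₀ Z) → p · f ≡ q · g →
    Σ[ w ∈ F₀ W ] ((w · u ≡ p) × (w · v ≡ q) × (∀ w' → w' · u ≡ p → w' · v ≡ q → w' ≡ w))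

  module _ {F : Presheaf 𝒞} (sheaf : IsAtomicSheaf 𝒞 F) where
    open Presheaf F

    ·-injective : (c : Hom B A) {x x' : F₀ A} → x · c ≡ x' · c → x ≡ x'
    ·-injective c {x} {x'} xc≡x'c = trans (unique x refl) (sym (unique x' (sym xc≡x'c)))
      where
      matching : ∀ {D} (d e : Hom D _) → c ∘ d ≡ c ∘ e → (x · c) · d ≡ (x · c) · e
      matching d e cd≡ce =
        trans (sym (act-∘ x c d)) (trans (cong (x ·_) cd≡ce) (act-∘ x c e))
      unique = proj₂ (proj₂ (sheaf c (x · c) matching))

    module _ (S : IndepPullbackStructure 𝒞) where
      open IndepPullbackStructure S

      -- Paste an independent square on (f, d) to the given one; the resulting rectangle over
      -- (v, u ∘ d) factors through the independent pullback (k₁, k₂), and the factorisation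
      -- acts injectively.
      agree-over-independent-pullback :
        ∀ {K} {f : Hom X Y} {g : Hom X Z} {u : Hom Y W} {v : Hom Z W} {p : F₀ Y} {q : F₀ Z} →
        Indep f g u v → p · f ≡ q · g →
        (d : Hom D Y) {k₁ : Hom K Z} {k₂ : Hom K D} → IsIndepPullback 𝒞 Indep k₁ k₂ v (u ∘ d) →
        (p · d) · k₂ ≡ q · k₁
      agree-over-independent-pullback {f = f} {g} {p = p} {q} ind pf≡qg d {k₁} {k₂} (_ , factor)
        with IP5 f d
      ... | _ , a , b , (iab , _) with factor (g ∘ a) b (IP3 iab (IP2 ind))
      ...   | h , k₁h≡ga , k₂h≡b , _ = ·-injective h (begin
        ((p · d) · k₂) · h  ≡⟨ sym (act-∘ (p · d) k₂ h) ⟩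
        (p · d) · (k₂ ∘ h)  ≡⟨ cong ((p · d) ·_) k₂h≡b ⟩
        (p · d) · b         ≡⟨ sym (act-∘ p d b) ⟩
        p · (d ∘ b)         ≡⟨ cong (p ·_) (sym (indep-comm iab)) ⟩
        p · (f ∘ a)         ≡⟨ act-∘ p f a ⟩
        (p · f) · a         ≡⟨ cong (_· a) pf≡qg ⟩
        (q · g) · a         ≡⟨ sym (act-∘ q g a) ⟩
        q · (g ∘ a)         ≡⟨ cong (q ·_) (sym k₁h≡ga) ⟩
        q · (k₁ ∘ h)        ≡⟨ act-∘ q k₁ h ⟩
        (q · k₁) · h        ∎)
        where open ≡-Reasoning

      independent-square-amalgamation :
        {f : Hom X Y} {g : Hom X Z} {u : Hom Y W} {v : Hom Z W} {p : F₀ Y} {q : F₀ Z} →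
        Indep f g u v → p · f ≡ q · g → Σ[ w ∈ F₀ W ] ((w · u ≡ p) × (w · v ≡ q))
      independent-square-amalgamation {u = u} {v} {p} {q} ind pf≡qg = w , wu≡p , wv≡q
        where
        agree : ∀ {D K} (d : Hom D _) {k₁ : Hom K _} {k₂ : Hom K D} →
                IsIndepPullback 𝒞 Indep k₁ k₂ v (u ∘ d) → (p · d) · k₂ ≡ q · k₁
        agree = agree-over-independent-pullback ind pf≡qg

        matching : ∀ {D} (d e : Hom D _) → u ∘ d ≡ u ∘ e → p · d ≡ p · e
        matching d e ud≡ue with IP5 v (u ∘ d)
        ... | _ , _ , k₂ , pullback = ·-injective k₂
          (trans (agree d pullback)
                 (sym (agree e (subst (IsIndepPullback 𝒞 Indep _ _ v) ud≡ue pullback))))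

        glued = sheaf u p matching
        w = proj₁ glued
        wu≡p = proj₁ (proj₂ glued)

        wv≡q : w · v ≡ q
        wv≡q with IP5 v u
        ... | _ , k₁ , k₂ , pullback = ·-injective k₁ (begin
          (w · v) · k₁   ≡⟨ sym (act-∘ w v k₁) ⟩
          w · (v ∘ k₁)   ≡⟨ cong (w ·_) (indep-comm (proj₁ pullback)) ⟩
          w · (u ∘ k₂)   ≡⟨ act-∘ w u k₂ ⟩
          (w · u) · k₂   ≡⟨ cong (_· k₂) (trans wu≡p (sym (act-id p))) ⟩
          (p · id) · k₂  ≡⟨ agree id (subst (IsIndepPullback 𝒞 Indep _ _ v) (sym (idʳ u)) pullback) ⟩
          q · k₁         ∎)
          where open ≡-Reasoning

      independent-square-to-pullback :
        {f : Hom X Y} {g : Hom X Z} {u : Hom Y W} {v : Hom Z W} →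
        Indep f g u v → MapsToPullback F f g u v
      independent-square-to-pullback {u = u} ind p q pf≡qg
        with independent-square-amalgamation ind pf≡qg
      ... | w , wu≡p , wv≡q =
        w , wu≡p , wv≡q , λ w' w'u≡p _ → ·-injective u (trans w'u≡p (sym wu≡p))

  module _ (AS : AssociatedSheaf 𝒞) where
    open AssociatedSheaf AS
    open Presheaf using (F₀; _·_; act-id; act-∘)

    ay : Obj → Presheaf 𝒞
    ay X = a₀ (y₀ 𝒞 X)

    generic : ∀ X → F₀ (ay X) X
    generic X = η (unit (y₀ 𝒞 X)) X id

    unit-generic : (h : Hom A X) → η (unit (y₀ 𝒞 X)) A h ≡ _·_ (ay X) (generic X) h
    unit-generic {X = X} h =
      trans (cong (η (unit (y₀ 𝒞 X)) _) (sym (idˡ h))) (natural (unit (y₀ 𝒞 X)) id h)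

    element : {F : Presheaf 𝒞} → _⇒_ 𝒞 (ay V) F → F₀ F V
    element {V = V} r = η r V (generic V)

    element-a₁ : (c : Hom X V) → element (a₁ (y₁ 𝒞 c)) ≡ _·_ (ay V) (generic V) c
    element-a₁ {X = X} {V} c = begin
      η (a₁ (y₁ 𝒞 c)) X (η (unit (y₀ 𝒞 X)) X id)  ≡⟨ unit-natural (y₁ 𝒞 c) X id ⟩
      η (unit (y₀ 𝒞 V)) X (c ∘ id)                ≡⟨ cong (η (unit (y₀ 𝒞 V)) X) (idʳ c) ⟩
      η (unit (y₀ 𝒞 V)) X c                       ≡⟨ unit-generic c ⟩
      _·_ (ay V) (generic V) c                    ∎
      where open ≡-Reasoning

    element-∘-a₁ : {F : Presheaf 𝒞} (r : _⇒_ 𝒞 (ay V) F) (c : Hom X V) →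
                   element (_∘N_ 𝒞 r (a₁ (y₁ 𝒞 c))) ≡ _·_ F (element r) c
    element-∘-a₁ r c = trans (cong (η r _) (element-a₁ c)) (natural r (generic _) c)

    element-a₁-∘ : (c : Hom V W) (d : Hom X V) →
                   element (_∘N_ 𝒞 (a₁ (y₁ 𝒞 c)) (a₁ (y₁ 𝒞 d))) ≡ _·_ (ay W) (generic W) (c ∘ d)
    element-a₁-∘ {W = W} c d = begin
      element (_∘N_ 𝒞 (a₁ (y₁ 𝒞 c)) (a₁ (y₁ 𝒞 d)))  ≡⟨ element-∘-a₁ (a₁ (y₁ 𝒞 c)) d ⟩
      _·_ (ay W) (element (a₁ (y₁ 𝒞 c))) d         ≡⟨ cong (λ x → _·_ (ay W) x d) (element-a₁ c) ⟩
      _·_ (ay W) (_·_ (ay W) (generic W) c) d      ≡⟨ sym (act-∘ (ay W) (generic W) c d) ⟩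
      _·_ (ay W) (generic W) (c ∘ d)               ∎
      where open ≡-Reasoning

    yoneda : {F : Presheaf 𝒞} → F₀ F V → _⇒_ 𝒞 (y₀ 𝒞 V) F
    yoneda {F = F} x = record { η = λ _ h → _·_ F x h ; natural = act-∘ F x }

    unit-element : {F : Presheaf 𝒞} (r : _⇒_ 𝒞 (ay V) F) →
                   _≈_ 𝒞 (_∘N_ 𝒞 r (unit (y₀ 𝒞 V))) (yoneda (element r))
    unit-element r A h = trans (cong (η r A) (unit-generic h)) (natural r (generic _) h)

    element-∘-a₁-≈ : {F : Presheaf 𝒞} (r : _⇒_ 𝒞 (ay V) F) (c : Hom X V) (s : _⇒_ 𝒞 (ay X) F) →
                     _≈_ 𝒞 (_∘N_ 𝒞 r (a₁ (y₁ 𝒞 c))) s → _·_ F (element r) c ≡ element s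
    element-∘-a₁-≈ {X = X} r c s rc≈s = trans (sym (element-∘-a₁ r c)) (rc≈s X (generic X))

    module _ {F : Presheaf 𝒞} (sheaf : IsAtomicSheaf 𝒞 F) where

      element-injective : (r r' : _⇒_ 𝒞 (ay V) F) → element r ≡ element r' → _≈_ 𝒞 r r'
      element-injective {V = V} r r' r≡r' A x =
        trans (unique r (unit-element r) A x) (sym (unique r' unit-element' A x))
        where
        unique = proj₂ (proj₂ (universal (y₀ 𝒞 V) F sheaf (yoneda (element r))))
        unit-element' : _≈_ 𝒞 (_∘N_ 𝒞 r' (unit (y₀ 𝒞 V))) (yoneda (element r))
        unit-element' B h = trans (unit-element r' B h) (cong (λ x → _·_ F x h) (sym r≡r'))

      extend : F₀ F V → _⇒_ 𝒞 (ay V) F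
      extend x = proj₁ (universal _ F sheaf (yoneda x))

      element-extend : (x : F₀ F V) → element (extend x) ≡ x
      element-extend {V = V} x =
        trans (proj₁ (proj₂ (universal _ F sheaf (yoneda x))) V id) (act-id F x)

      extend-∘-a₁ : {w : F₀ F W} {c : Hom V W} (r : _⇒_ 𝒞 (ay V) F) → _·_ F w c ≡ element r →
                    _≈_ 𝒞 (_∘N_ 𝒞 (extend w) (a₁ (y₁ 𝒞 c))) r
      extend-∘-a₁ {w = w} {c} r wc≡r = element-injective (_∘N_ 𝒞 (extend w) (a₁ (y₁ 𝒞 c))) r (begin
        element (_∘N_ 𝒞 (extend w) (a₁ (y₁ 𝒞 c)))  ≡⟨ element-∘-a₁ (extend w) c ⟩
        _·_ F (element (extend w)) c               ≡⟨ cong (λ x → _·_ F x c) (element-extend w) ⟩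
        _·_ F w c                                  ≡⟨ wc≡r ⟩
        element r                                  ∎)
        where open ≡-Reasoning

      ≈-extend : {w : F₀ F V} (k : _⇒_ 𝒞 (ay V) F) → element k ≡ w → _≈_ 𝒞 k (extend w)
      ≈-extend {w = w} k k≡w = element-injective k (extend w) (trans k≡w (sym (element-extend w)))

    ay-pushout-from-sheaf-pullbacks : (f : Hom X Y) (g : Hom X Z) (u : Hom Y W) (v : Hom Z W) →
                 u ∘ f ≡ v ∘ g → (∀ F → IsAtomicSheaf 𝒞 F → MapsToPullback F f g u v) →
                 IsPushoutSh 𝒞 (a₁ (y₁ 𝒞 f)) (a₁ (y₁ 𝒞 g)) (a₁ (y₁ 𝒞 u)) (a₁ (y₁ 𝒞 v))
    ay-pushout-from-sheaf-pullbacks {W = W} f g u v uf≡vg pullback = commutes , λ F sheaf p q pf≈qg →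
      let (w , wu≡p , wv≡q , w-unique) = pullback F sheaf (element p) (element q)
            (trans (element-∘-a₁-≈ p f (_∘N_ 𝒞 q (a₁ (y₁ 𝒞 g))) pf≈qg) (element-∘-a₁ q g))
      in extend sheaf w , extend-∘-a₁ sheaf p wu≡p , extend-∘-a₁ sheaf q wv≡q ,
         λ k' k'u≈p k'v≈q →
           ≈-extend sheaf k'
             (w-unique (element k') (element-∘-a₁-≈ k' u p k'u≈p) (element-∘-a₁-≈ k' v q k'v≈q))
      where
      commutes : _≈_ 𝒞 (_∘N_ 𝒞 (a₁ (y₁ 𝒞 u)) (a₁ (y₁ 𝒞 f))) (_∘N_ 𝒞 (a₁ (y₁ 𝒞 v)) (a₁ (y₁ 𝒞 g)))
      commutes = element-injective (a₀-sheaf (y₀ 𝒞 W)) (_∘N_ 𝒞 (a₁ (y₁ 𝒞 u)) (a₁ (y₁ 𝒞 f)))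
        (_∘N_ 𝒞 (a₁ (y₁ 𝒞 v)) (a₁ (y₁ 𝒞 g)))
        (trans (element-a₁-∘ u f)
          (trans (cong (_·_ (ay W) (generic W)) uf≡vg) (sym (element-a₁-∘ v g))))

corollary6p5 : (𝒞 : Category) (S : IndepPullbackStructure 𝒞) (A : AssociatedSheaf 𝒞) →
    let open Category 𝒞
        open IndepPullbackStructure S
        open AssociatedSheaf A
    in ∀ {X Y Z W} (f : Hom X Y) (g : Hom X Z) (u : Hom Y W) (v : Hom Z W) →
       Indep f g u v →
       IsPushoutSh 𝒞 (a₁ (y₁ 𝒞 f)) (a₁ (y₁ 𝒞 g)) (a₁ (y₁ 𝒞 u)) (a₁ (y₁ 𝒞 v))
corollary6p5 𝒞 S A f g u v ind =
  ay-pushout-from-sheaf-pullbacks A f g u v (IndepPullbackStructure.indep-comm S ind)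
    (λ F sheaf → independent-square-to-pullback {F = F} sheaf S ind)
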